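{- If $T$ is a non-special tree with no uncountable chains, then the comparability graph $G=G(T)$ satisfies $Chr(G)>\omega$, while every uncountable set $A$ of vertices can be separated by a countable set, i.e. there are a countable set $F$ and distinct $s,t\in A$ such that every path in $G$ from $s$ to $t$ meets $F$.
   Context: A tree is a partial order in which the set of predecessors of each element is well ordered; it is special if it is a union of countably many antichains. $G(T)$ has vertex set $T$ and edges between distinct comparable elements. $Chr$ denotes chromatic number. -}

module Defs where

open import Level using (0ℓ)
open import Data.Nat using (ℕ)
open import Data.Product using (Σ; ∃; _×_; _,_)
open import Data.Sum using (_⊎_)
open import Data.Empty using (⊥)
open import Data.List using (List; []; _∷_)
open import Data.List.Relation.Unary.Any using (Any)
open import Data.List.Relation.Unary.Unique.Propositional using (Unique)
open import Relation.Nullary using (¬_)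
open import Relation.Binary.PropositionalEquality using (_≡_; _≢_)
open import Relation.Binary.Structures using (IsPartialOrder)

record PartialOrder : Set₁ where
  field
    Carrier : Set
    _≤_     : Carrier → Carrier → Set
    isPartialOrder : IsPartialOrder _≡_ _≤_

  _<_ : Carrier → Carrier → Set
  x < y = x ≤ y × x ≢ y

module _ (P : PartialOrder) where
  open PartialOrder P

  PredsWellOrdered : Carrier → Set₁
  PredsWellOrdered x =
    (∀ y z → y < x → z < x → (y ≤ z ⊎ z ≤ y)) ×
    (∀ (S : Carrier → Set) → (∃ λ y → y < x × S y) →
       ∃ λ m → m < x × S m × (∀ y → y < x → S y → m ≤ y))

record Tree : Set₁ where
  field
    order : PartialOrder
  open PartialOrder order public
  field
    predsWellOrdered : ∀ x → PredsWellOrdered order x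

module _ (T : Tree) where
  open Tree T

  Countable : (Carrier → Set) → Set
  Countable S = Σ (Carrier → ℕ) λ f → ∀ x y → S x → S y → f x ≡ f y → x ≡ y

  Uncountable : (Carrier → Set) → Set
  Uncountable S = ¬ Countable S

  Chain : (Carrier → Set) → Set
  Chain C = ∀ x y → C x → C y → x ≤ y ⊎ y ≤ x

  Antichain : (Carrier → Set) → Set
  Antichain A = ∀ x y → A x → A y → x ≤ y → x ≡ y

  Special : Set₁
  Special = Σ (ℕ → Carrier → Set) λ A → (∀ n → Antichain (A n)) × (∀ x → ∃ λ n → A n x)

  Adj : Carrier → Carrier → Set
  Adj x y = x ≢ y × (x ≤ y ⊎ y ≤ x)

  ChrGreaterThanω : Set
  ChrGreaterThanω = ¬ (Σ (Carrier → ℕ) λ c → ∀ x y → Adj x y → c x ≢ c y)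

  data Walk : Carrier → Carrier → Set where
    stay : ∀ x → Walk x x
    step : ∀ {x y z} → Adj x y → Walk y z → Walk x z

  vertices : ∀ {s t} → Walk s t → List Carrier
  vertices (stay x)     = x ∷ []
  vertices (step {x} _ w) = x ∷ vertices w

  Path : Carrier → Carrier → Set
  Path s t = Σ (Walk s t) λ w → Unique (vertices w)

  Separates : (Carrier → Set) → Carrier → Carrier → Set
  Separates F s t = ¬ F s × ¬ F t × (∀ (p : Path s t) → Any F (vertices (Data.Product.proj₁ p)))

-- A proper colouring of G(T) with ω colours has antichains as colour classes, so T would be
-- special. For the separation: an uncountable A is not a chain, so it contains incomparable
-- s, t; the predecessors of s form a chain, hence are countable, and they separate s from t.
-- Indeed a path leaving s upwards stays strictly above s as long as it avoids the
-- predecessors of s: a step down from x > s lands on some y < x, and y is comparable with s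
-- because the predecessors of x are linearly ordered. Since t is not above s, the path
-- must meet a predecessor of s.
module Submission where

open import Defs
open import Level using (0ℓ)
open import Axiom.ExcludedMiddle using (ExcludedMiddle)
open import Function using (_∘_)
open import Data.Nat using (ℕ)
open import Data.Product using (Σ; ∃; _×_; _,_; proj₁)
open import Data.Sum using (inj₁; inj₂)
open import Data.Empty using (⊥-elim)
open import Data.List.Relation.Unary.All using (All; _∷_)
open import Data.List.Relation.Unary.Any using (Any; here; there)
open import Data.List.Relation.Unary.AllPairs using (_∷_)
open import Relation.Nullary using (¬_)
open import Relation.Nullary.Decidable using (decidable-stable)
open import Relation.Binary.PropositionalEquality using (_≡_; _≢_; refl; sym; ≢-sym)
open import Relation.Binary.Structures using (IsPartialOrder)

module _ (T : Tree) where
  open Tree T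
  open IsPartialOrder isPartialOrder using (reflexive; trans)

  _∥_ : Carrier → Carrier → Set
  x ∥ y = ¬ x ≤ y × ¬ y ≤ x

  ∥⇒≢ : ∀ {x y} → x ∥ y → x ≢ y
  ∥⇒≢ (x≰y , _) x≡y = x≰y (reflexive x≡y)

  Predecessors : Carrier → Carrier → Set
  Predecessors s y = y < s

  predecessors-chain : ∀ s → Chain T (Predecessors s)
  predecessors-chain s x y = proj₁ (predsWellOrdered s) x y

  head-All : ∀ {P : Carrier → Set} {y z} (w : Walk T y z) → All P (vertices T w) → P y
  head-All (stay _)   (p ∷ _) = p
  head-All (step _ _) (p ∷ _) = p

  head-Any : ∀ {P : Carrier → Set} {y z} (w : Walk T y z) → P y → Any P (vertices T w)
  head-Any (stay _)   p = here p
  head-Any (step _ _) p = here p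

  walk-from-above-meets-predecessors :
    ∀ s {x t} (w : Walk T x t) → s < x → All (s ≢_) (vertices T w) → ¬ s ≤ t →
    Any (Predecessors s) (vertices T w)
  walk-from-above-meets-predecessors s (stay _) (s≤x , _) _ s≰t = ⊥-elim (s≰t s≤x)
  walk-from-above-meets-predecessors s (step (_ , inj₁ x≤y) w) (s≤x , _) (_ ∷ s≢w) s≰t =
    there (walk-from-above-meets-predecessors s w
             (trans s≤x x≤y , head-All w s≢w) s≢w s≰t)
  walk-from-above-meets-predecessors s {x} (step {y = y} (x≢y , inj₂ y≤x) w) s<x (_ ∷ s≢w) s≰t
    with predecessors-chain x y s (y≤x , ≢-sym x≢y) s<x
  ... | inj₁ y≤s = there (head-Any w (y≤s , ≢-sym (head-All w s≢w)))
  ... | inj₂ s≤y = there (walk-from-above-meets-predecessors s w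
                            (s≤y , head-All w s≢w) s≢w s≰t)

  predecessors-separate-incomparable : ∀ {s t} → s ∥ t → Separates T (Predecessors s) s t
  predecessors-separate-incomparable {s} {t} (s≰t , t≰s) =
    (λ (_ , s≢s) → s≢s refl) , (λ (t≤s , _) → t≰s t≤s) , meets
    where
    meets : (p : Path T s t) → Any (Predecessors s) (vertices T (proj₁ p))
    meets (stay _ , _) = ⊥-elim (s≰t (reflexive refl))
    meets (step (s≢y , inj₂ y≤s) w , _) = there (head-Any w (y≤s , ≢-sym s≢y))
    meets (step (s≢y , inj₁ s≤y) w , s∉w ∷ _) =
      there (walk-from-above-meets-predecessors s w (s≤y , s≢y) s∉w s≰t)

  module _ (em : ExcludedMiddle 0ℓ) where

    proper-colouring⇒special :
      (c : Carrier → ℕ) → (∀ x y → Adj T x y → c x ≢ c y) → Special T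
    proper-colouring⇒special c proper =
      (λ n x → c x ≡ n) , colour-class-antichain , λ x → c x , refl
      where
      colour-class-antichain : ∀ n → Antichain T (λ x → c x ≡ n)
      colour-class-antichain n x y refl cy≡cx x≤y =
        decidable-stable em λ x≢y → proper x y (x≢y , inj₁ x≤y) (sym cy≡cx)

    non-chain⇒incomparable-pair :
      ∀ {A : Carrier → Set} → ¬ Chain T A → ∃ λ s → ∃ λ t → A s × A t × s ∥ t
    non-chain⇒incomparable-pair ¬chain = decidable-stable em λ no-pair →
      ¬chain λ x y Ax Ay → decidable-stable em λ ¬comparable →
        no-pair (x , y , Ax , Ay , ¬comparable ∘ inj₁ , ¬comparable ∘ inj₂)

    uncountable⇒separated-pair :
      (∀ C → Chain T C → ¬ Uncountable T C) →
      ∀ A → Uncountable T A →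
      Σ (Carrier → Set) λ F → Countable T F ×
        (∃ λ s → ∃ λ t → A s × A t × s ≢ t × Separates T F s t)
    uncountable⇒separated-pair chains-countable A A-uncountable =
      let (s , t , As , At , s∥t) = non-chain⇒incomparable-pair
                                      λ A-chain → chains-countable A A-chain A-uncountable
      in Predecessors s
       , decidable-stable em (chains-countable (Predecessors s) (predecessors-chain s))
       , s , t , As , At , ∥⇒≢ s∥t , predecessors-separate-incomparable s∥t

corollary1 : ExcludedMiddle 0ℓ → (T : Tree) →
    ¬ Special T →
    (∀ (C : Tree.Carrier T → Set) → Chain T C → ¬ Uncountable T C) →
    ChrGreaterThanω T ×
    (∀ (A : Tree.Carrier T → Set) → Uncountable T A →
    Σ (Tree.Carrier T → Set) λ F → Countable T F ×
    (∃ λ s → ∃ λ t → A s × A t × s ≢ t × Separates T F s t))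
corollary1 em T non-special chains-countable =
    (λ (c , proper) → non-special (proper-colouring⇒special T em c proper))
  , uncountable⇒separated-pair T em chains-countable
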